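{- The sets $R_{1,0}=\{2,5,7,10,\dots\}$, $R_{1,1}=\{1,4,6,9,\dots\}$ and $R_{2,0}=\{3,8,11,16,\dots\}$ are pairwise disjoint and their union is $\mathbb N$.
   Context: Let $\varphi=\frac{1+\sqrt5}{2}$ and $\mathbb N=\{1,2,3,\dots\}$; $a(n)=\lfloor n\varphi\rfloor$. $F$ is the Fibonacci sequence, $F(0)=0$, $F(1)=F(2)=1$, $F(n)=F(n-1)+F(n-2)$. For $i\in\mathbb Z^{\geq0}$, $j\in\mathbb Z$, let $f_{i,j}(n)=F(i+1)a(n)+F(i)n-j$ ($n\in\mathbb N$) and $R_{i,j}=\{f_{i,j}(n)\mid n\in\mathbb N\}$. Concretely, $R_{1,0}=\{a(n)+n\}$, $R_{1,1}=\{a(n)+n-1\}$, $R_{2,0}=\{2a(n)+n\}$. -}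

module Defs where

open import Data.Nat using (ℕ; zero; suc; _+_; _*_; _≤ᵇ_; _/_; _≥_; _≡ᵇ_)
open import Data.Bool using (if_then_else_)
open import Data.Product using (∃-syntax; _×_)
open import Relation.Binary.PropositionalEquality using (_≡_)

F : ℕ → ℕ
F zero = zero
F (suc zero) = suc zero
F (suc (suc n)) = F (suc n) + F n

isqrtUpTo : ℕ → ℕ → ℕ
isqrtUpTo zero x = zero
isqrtUpTo (suc b) x = if (suc b * suc b) ≤ᵇ x then suc b else isqrtUpTo b x

-- integer square root: ⌊√x⌋ (search bound x suffices since r*r ≤ x ⇒ r ≤ x)
isqrt : ℕ → ℕ
isqrt x = isqrtUpTo x x

-- a n = ⌊ n φ ⌋ = ⌊ (n + n√5) / 2 ⌋ = ⌊ (n + ⌊√(5 n²)⌋) / 2 ⌋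
a : ℕ → ℕ
a n = (n + isqrt (5 * (n * n))) / 2

-- f_{i,j}(n) = F(i+1) a(n) + F(i) n - j ; only j ∈ {0,1} needed, all values in ℕ here.
-- Membership in R_{i,j} (a subset of ℤ in general) stated with j as a natural subtrahend:
-- k ∈ R_{i,j}  ⇔  ∃ n ≥ 1, k + j = F(i+1) a(n) + F(i) n
InR : ℕ → ℕ → ℕ → Set
InR i j k = ∃[ n ] (n ≥ 1 × k + j ≡ F (suc i) * a n + F i * n)

-- Write a n = ⌊nφ⌋ and b n = a n + n = ⌊nφ²⌋. Whether m < nφ is decided by the sign of
-- m² − mn − n², which never vanishes for n ≥ 1; this gives m ≤ a n ⇔ m < nφ, and since
-- φ² = φ + 1 the Galois-type law p ≤ a q ⇔ a p < p + q. Together with 1 ≤ a (n + 1) − a n ≤ 2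
-- it yields a (a n) = b n − 1 and a (b n) = a n + b n, so that R₁₀, R₁₁, R₂₀ are the images of
-- the positive integers under b, a ∘ a and a ∘ b. The theorem then follows from the Beatty
-- partition of the positive integers into the images of a and b (a jump a (p + 1) = a p + 2
-- forces p = a j, so the skipped value a p + 1 is a (a j) + 1 = b j), and injectivity of a.

module Submission where

open import Defs
open import Data.Nat
open import Data.Nat.Properties
open import Data.Nat.DivMod using (m/n*n≤m; m*n/n≡m; /-monoˡ-≤)
open import Data.Nat.Induction using (<-wellFounded)
open import Data.Nat.Tactic.RingSolver using (solve; solve-∀)
open import Data.Bool using (true; false; T)
open import Data.List using (_∷_; [])
open import Data.Product using (∃-syntax; _×_; _,_)
open import Data.Sum using (_⊎_; inj₁; inj₂)
open import Data.Unit using (tt)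
open import Function using (_∘_)
open import Function.Bundles using (_⇔_; mk⇔; Equivalence)
open import Function.Properties.Equivalence using (⇔-setoid) renaming (trans to ⇔-trans)
open import Induction.WellFounded using (Acc; acc)
open import Level using (0ℓ)
open import Relation.Nullary using (¬_; yes; no; contradiction)
open import Relation.Binary.Definitions using (tri<; tri≈; tri>)
open import Relation.Binary.PropositionalEquality
import Relation.Binary.Reasoning.Setoid as SetoidReasoning

open Equivalence using (to; from)
module ⇔-Reasoning = SetoidReasoning (⇔-setoid 0ℓ)

isqrtUpTo-sq≤ : ∀ u x → isqrtUpTo u x * isqrtUpTo u x ≤ x
isqrtUpTo-sq≤ zero    x = z≤n
isqrtUpTo-sq≤ (suc u) x with suc u * suc u ≤ᵇ x in eq
... | true  = ≤ᵇ⇒≤ (suc u * suc u) x (subst T (sym eq) tt)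
... | false = isqrtUpTo-sq≤ u x

sq≤⇒≤isqrtUpTo : ∀ u {r x} → r ≤ u → r * r ≤ x → r ≤ isqrtUpTo u x
sq≤⇒≤isqrtUpTo zero    r≤0 _ = r≤0
sq≤⇒≤isqrtUpTo (suc u) {r} {x} r≤1+u r²≤x with suc u * suc u ≤ᵇ x in eq
... | true  = r≤1+u
... | false with m≤n⇒m<n∨m≡n r≤1+u
...   | inj₁ r<1+u = sq≤⇒≤isqrtUpTo u (<⇒≤pred r<1+u) r²≤x
...   | inj₂ refl  = contradiction (≤⇒≤ᵇ r²≤x) (subst T eq)

≤isqrt⇔sq≤ : ∀ {r x} → r ≤ isqrt x ⇔ r * r ≤ x
≤isqrt⇔sq≤ {r} {x} = mk⇔
  (λ r≤s → ≤-trans (*-mono-≤ r≤s r≤s) (isqrtUpTo-sq≤ x x))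
  (λ r²≤x → sq≤⇒≤isqrtUpTo x (≤-trans (m≤m*m r) r²≤x) r²≤x)
  where
  m≤m*m : ∀ m → m ≤ m * m
  m≤m*m zero    = z≤n
  m≤m*m (suc m) = m≤m*n (suc m) (suc m)

≤/2⇔*2≤ : ∀ {m n} → m ≤ n / 2 ⇔ m * 2 ≤ n
≤/2⇔*2≤ {m} {n} = mk⇔
  (λ m≤n/2 → ≤-trans (*-monoˡ-≤ 2 m≤n/2) (m/n*n≤m n 2))
  (λ 2m≤n → subst (_≤ n / 2) (m*n/n≡m m 2) (/-monoˡ-≤ 2 2m≤n))

≤-exchange : ∀ {x y c d} → x + c ≡ y + d → x ≤ d → y ≤ c
≤-exchange {x} {y} {c} {d} x+c≡y+d x≤d = +-cancelʳ-≤ d y c (begin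
  y + d ≡⟨ x+c≡y+d ⟨
  x + c ≤⟨ +-monoˡ-≤ c x≤d ⟩
  d + c ≡⟨ +-comm d c ⟩
  c + d ∎)
  where open ≤-Reasoning

≡-cong₂⇔ : ∀ {x x′ y y′ : ℕ} → x ≡ x′ → y ≡ y′ → (x ≡ y) ⇔ (x′ ≡ y′)
≡-cong₂⇔ x≡x′ y≡y′ = mk⇔ (λ x≡y → trans (sym x≡x′) (trans x≡y y≡y′))
                         (λ x′≡y′ → trans x≡x′ (trans x′≡y′ (sym y≡y′)))

module StrictlyIncreasing {f : ℕ → ℕ} (f-<-suc : ∀ n → f n < f (suc n)) where

  mono-< : ∀ {m n} → m < n → f m < f n
  mono-< {m} {suc n} (s≤s m≤n) with m≤n⇒m<n∨m≡n m≤n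
  ... | inj₁ m<n  = <-trans (mono-< m<n) (f-<-suc n)
  ... | inj₂ refl = f-<-suc m

  injective : ∀ {m n} → f m ≡ f n → m ≡ n
  injective {m} {n} fm≡fn with <-cmp m n
  ... | tri< m<n _ _ = contradiction fm≡fn (<⇒≢ (mono-< m<n))
  ... | tri≈ _ m≡n _ = m≡n
  ... | tri> _ _ n<m = contradiction (sym fm≡fn) (<⇒≢ (mono-< n<m))

  bracket : ∀ {k} → f 0 ≤ k → ∃[ n ] (f n ≤ k × k < f (suc n))
  bracket {zero} f0≤0 = 0 , f0≤0 , ≤-<-trans z≤n (f-<-suc 0)
  bracket {suc k} f0≤1+k with f 0 ≤? k
  ... | no f0≰k = 0 , f0≤1+k , ≤-<-trans (≰⇒> f0≰k) (f-<-suc 0)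
  ... | yes f0≤k with bracket f0≤k
  ...   | n , fn≤k , k<f[1+n] with suc k <? f (suc n)
  ...     | yes 1+k<f[1+n] = n , m≤n⇒m≤1+n fn≤k , 1+k<f[1+n]
  ...     | no 1+k≮f[1+n]  = suc n , ≮⇒≥ 1+k≮f[1+n] , ≤-<-trans k<f[1+n] (f-<-suc (suc n))

-- m < n ·φ encodes m < nφ: for x = m / n, x² < x + 1 holds exactly when x < φ.
_<_·φ : ℕ → ℕ → Set
m < n ·φ = m * m < m * n + n * n

_·φ<_ : ℕ → ℕ → Set
n ·φ< m = m * n + n * n < m * m

≤⇒<·φ : ∀ {m n} → 1 ≤ n → m ≤ n → m < n ·φ
≤⇒<·φ {m} {n} 1≤n m≤n = begin-strict
  m * m         ≤⟨ *-monoʳ-≤ m m≤n ⟩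
  m * n         <⟨ m<m+n (m * n) (*-mono-≤ 1≤n 1≤n) ⟩
  m * n + n * n ∎
  where open ≤-Reasoning

-- Infinite descent: a solution (n + d, n) yields the smaller solution (n, d).
golden-irrational : ∀ {m n} → 1 ≤ n → m * m ≢ m * n + n * n
golden-irrational {m} {n} = descend m n (<-wellFounded n)
  where
  shrink : ∀ n d → (n + d) * (n + d) ≡ (n + d) * n + n * n → n * n ≡ n * d + d * d
  shrink n d eq = +-cancelˡ-≡ (n * n + n * d) _ _ (begin
    n * n + n * d + n * n       ≡⟨ solve (n ∷ d ∷ []) ⟩
    (n + d) * n + n * n         ≡⟨ eq ⟨
    (n + d) * (n + d)           ≡⟨ solve (n ∷ d ∷ []) ⟩
    n * n + n * d + (n * d + d * d) ∎)
    where open ≡-Reasoning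

  descend : ∀ m n → Acc _<_ n → 1 ≤ n → m * m ≢ m * n + n * n
  descend m n (acc rec) 1≤n eq with ≤-<-connex m n
  ... | inj₁ m≤n = <⇒≢ (≤⇒<·φ 1≤n m≤n) eq
  ... | inj₂ n<m with m≤n⇒∃[o]m+o≡n (<⇒≤ n<m)
  ...   | d , refl = descend n d (rec d<n) 1≤d eq′
    where
    eq′ : n * n ≡ n * d + d * d
    eq′ = shrink n d eq
    1≤d : 1 ≤ d
    1≤d = +-cancelˡ-< n 0 d (subst (_< n + d) (sym (+-identityʳ n)) n<m)
    d<n : d < n
    d<n = ≰⇒> λ n≤d → <⇒≢ (≤⇒<·φ 1≤d n≤d) eq′

·φ≮⇒<·φ : ∀ {m n} → 1 ≤ n → ¬ (n ·φ< m) → m < n ·φ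
·φ≮⇒<·φ {m} 1≤n nφ≮m = ≤∧≢⇒< (≮⇒≥ nφ≮m) (golden-irrational {m} 1≤n)

+<·φ⇔·φ< : ∀ {m n} → (m + n) < m ·φ ⇔ n ·φ< m
+<·φ⇔·φ< {m} {n} = mk⇔
  (λ lt → +-cancelˡ-< (m * m + m * n) _ _ (subst₂ _<_ lhs rhs lt))
  (λ lt → subst₂ _<_ (sym lhs) (sym rhs) (+-monoʳ-< (m * m + m * n) lt))
  where
  lhs : (m + n) * (m + n) ≡ m * m + m * n + (m * n + n * n)
  lhs = solve (m ∷ n ∷ [])
  rhs : (m + n) * m + m * m ≡ m * m + m * n + m * m
  rhs = solve (m ∷ n ∷ [])

<·φ⇒<2* : ∀ {m n} → m < n ·φ → m < 2 * n
<·φ⇒<2* {m} {n} m<nφ = ≰⇒> λ 2n≤m → <⇒≱ {m * m} m<nφ (begin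
  m * n + n * n ≤⟨ +-monoʳ-≤ (m * n) (*-monoʳ-≤ n (≤-trans (m≤m+n n (n + 0)) 2n≤m)) ⟩
  m * n + n * m ≡⟨ solve (m ∷ n ∷ []) ⟩
  2 * n * m     ≤⟨ *-monoˡ-≤ m 2n≤m ⟩
  m * m         ∎)
  where open ≤-Reasoning

<·φ-suc : ∀ {m n} → m < n ·φ → suc m < suc n ·φ
<·φ-suc {m} {n} m<nφ = begin-strict
  suc m * suc m                     ≡⟨ solve (m ∷ []) ⟩
  m * m + (m + m + 1)               <⟨ +-mono-<-≤ m<nφ (+-monoˡ-≤ 1 (+-monoʳ-≤ m m≤3n)) ⟩
  m * n + n * n + (m + 3 * n + 1)   ≤⟨ m≤m+n _ 1 ⟩
  m * n + n * n + (m + 3 * n + 1) + 1 ≡⟨ solve (m ∷ n ∷ []) ⟩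
  suc m * suc n + suc n * suc n     ∎
  where
  open ≤-Reasoning
  m≤3n : m ≤ 3 * n
  m≤3n = ≤-trans (<⇒≤ (<·φ⇒<2* m<nφ)) (*-monoˡ-≤ n (n≤1+n 2))

discriminant : ∀ {m n t} → n + t ≡ m * 2 → t * t + 4 * (m * n + n * n) ≡ 4 * (m * m) + 5 * (n * n)
discriminant {m} {n} {t} n+t≡2m = begin
  t * t + 4 * (m * n + n * n)         ≡⟨ solve (m ∷ n ∷ t ∷ []) ⟩
  t * t + 2 * (m * 2) * n + 4 * (n * n) ≡⟨ cong (λ u → t * t + 2 * u * n + 4 * (n * n)) n+t≡2m ⟨
  t * t + 2 * (n + t) * n + 4 * (n * n) ≡⟨ solve (n ∷ t ∷ []) ⟩
  (n + t) * (n + t) + 5 * (n * n)     ≡⟨ cong (λ u → u * u + 5 * (n * n)) n+t≡2m ⟩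
  m * 2 * (m * 2) + 5 * (n * n)       ≡⟨ solve (m ∷ n ∷ []) ⟩
  4 * (m * m) + 5 * (n * n)           ∎
  where open ≡-Reasoning

sq≤5*sq⇔<·φ : ∀ {m n t} → 1 ≤ n → n + t ≡ m * 2 → t * t ≤ 5 * (n * n) ⇔ m < n ·φ
sq≤5*sq⇔<·φ {m} {n} {t} 1≤n n+t≡2m = mk⇔
  (λ t²≤5n² → ≤∧≢⇒< (*-cancelˡ-≤ 4 (≤-exchange disc t²≤5n²)) (golden-irrational {m} 1≤n))
  (λ m<nφ → ≤-exchange (sym disc) (*-monoʳ-≤ 4 (<⇒≤ m<nφ)))
  where
  disc : t * t + 4 * (m * n + n * n) ≡ 4 * (m * m) + 5 * (n * n)
  disc = discriminant {m} {n} {t} n+t≡2m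

≤a⇔<·φ : ∀ {m n} → 1 ≤ n → m ≤ a n ⇔ m < n ·φ
≤a⇔<·φ {m} {n} 1≤n with ≤-<-connex (m * 2) n
... | inj₁ 2m≤n = mk⇔
  (λ _ → ≤⇒<·φ 1≤n (≤-trans (m≤m*n m 2) 2m≤n))
  (λ _ → from ≤/2⇔*2≤ (≤-trans 2m≤n (m≤m+n n _)))
... | inj₂ n<2m with m≤n⇒∃[o]m+o≡n (<⇒≤ n<2m)
...   | t , n+t≡2m = begin
  m ≤ a n                 ≈⟨ ≤/2⇔*2≤ ⟩
  m * 2 ≤ n + s           ≈⟨ mk⇔ (+-cancelˡ-≤ n t s ∘ subst (_≤ n + s) (sym n+t≡2m))
                                 (subst (_≤ n + s) n+t≡2m ∘ +-monoʳ-≤ n) ⟩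
  t ≤ s                   ≈⟨ ≤isqrt⇔sq≤ ⟩
  t * t ≤ 5 * (n * n)     ≈⟨ sq≤5*sq⇔<·φ {m} 1≤n n+t≡2m ⟩
  m < n ·φ                ∎
  where
  open ⇔-Reasoning
  s = isqrt (5 * (n * n))

n≤a : ∀ {n} → 1 ≤ n → n ≤ a n
n≤a 1≤n = from (≤a⇔<·φ 1≤n) (≤⇒<·φ 1≤n ≤-refl)

1≤a : ∀ {n} → 1 ≤ n → 1 ≤ a n
1≤a 1≤n = ≤-trans 1≤n (n≤a 1≤n)

a-<-suc : ∀ n → a n < a (suc n)
a-<-suc zero    = s≤s z≤n
a-<-suc (suc n) =
  from (≤a⇔<·φ {n = suc (suc n)} (s≤s z≤n))
       (<·φ-suc {a (suc n)} {suc n} (to (≤a⇔<·φ {a (suc n)} {suc n} (s≤s z≤n)) ≤-refl))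

-- As φ² = φ + 1, p < qφ holds iff pφ < p + q.
≤a⇔a<+ : ∀ {p q} → 1 ≤ p → 1 ≤ q → p ≤ a q ⇔ a p < p + q
≤a⇔a<+ {p} {q} 1≤p 1≤q = mk⇔
  (λ p≤aq → ≰⇒> λ p+q≤ap →
     <-asym (to (≤a⇔<·φ {p} 1≤q) p≤aq) (to (+<·φ⇔·φ< {p} {q}) (to (≤a⇔<·φ {p + q} 1≤p) p+q≤ap)))
  (λ ap<p+q → from (≤a⇔<·φ {p} 1≤q) (·φ≮⇒<·φ {p} 1≤q λ qφ<p →
     <⇒≱ ap<p+q (from (≤a⇔<·φ {p + q} 1≤p) (from (+<·φ⇔·φ< {p} {q}) qφ<p))))

n+c≡a⇒≤a[1+c] : ∀ {n c} → 1 ≤ n → n + c ≡ a n → n ≤ a (suc c)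
n+c≡a⇒≤a[1+c] {n} {c} 1≤n n+c≡an =
  from (≤a⇔a<+ 1≤n (s≤s z≤n)) (subst (_< n + suc c) n+c≡an (+-monoʳ-< n ≤-refl))

a-suc≤2+a : ∀ {n} → 1 ≤ n → a (suc n) ≤ 2 + a n
a-suc≤2+a {n} 1≤n with m≤n⇒∃[o]m+o≡n (n≤a 1≤n)
... | c , n+c≡an = s≤s⁻¹ (begin-strict
  a (suc n)           <⟨ to (≤a⇔a<+ (s≤s z≤n) (s≤s z≤n)) n<a[2+c] ⟩
  suc n + suc (suc c) ≡⟨ solve (n ∷ c ∷ []) ⟩
  3 + (n + c)         ≡⟨ cong (3 +_) n+c≡an ⟩
  3 + a n             ∎)
  where
  open ≤-Reasoning
  n<a[2+c] : n < a (suc (suc c))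
  n<a[2+c] = ≤-<-trans (n+c≡a⇒≤a[1+c] 1≤n n+c≡an) (a-<-suc (suc c))

b : ℕ → ℕ
b n = a n + n

1≤b : ∀ {n} → 1 ≤ n → 1 ≤ b n
1≤b {n} 1≤n = ≤-trans 1≤n (m≤n+m n (a n))

a∘a<b : ∀ {n} → 1 ≤ n → a (a n) < b n
a∘a<b 1≤n = to (≤a⇔a<+ (1≤a 1≤n) 1≤n) ≤-refl

b<a∘suc∘a : ∀ {n} → 1 ≤ n → b n < a (suc (a n))
b<a∘suc∘a 1≤n = ≮⇒≥ λ lt → 1+n≰n (from (≤a⇔a<+ (s≤s z≤n) 1≤n) lt)

suc∘a∘a≡b : ∀ {n} → 1 ≤ n → suc (a (a n)) ≡ b n
suc∘a∘a≡b 1≤n = ≤-antisym (a∘a<b 1≤n)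
  (s≤s⁻¹ (≤-trans (b<a∘suc∘a 1≤n) (a-suc≤2+a (1≤a 1≤n))))

a∘b≡a+b : ∀ {n} → 1 ≤ n → a (b n) ≡ a n + b n
a∘b≡a+b {n} 1≤n = ≤-antisym (s≤s⁻¹ upper) (≮⇒≥ lower)
  where
  open ≤-Reasoning
  upper : a (b n) < suc (a n + b n)
  upper = begin-strict
    a (b n)         <⟨ to (≤a⇔a<+ (1≤b 1≤n) (s≤s z≤n)) (<⇒≤ (b<a∘suc∘a 1≤n)) ⟩
    b n + suc (a n) ≡⟨ +-suc (b n) (a n) ⟩
    suc (b n + a n) ≡⟨ cong suc (+-comm (b n) (a n)) ⟩
    suc (a n + b n) ∎
  lower : ¬ (a (b n) < a n + b n)
  lower lt = <⇒≱ (a∘a<b 1≤n)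
    (from (≤a⇔a<+ (1≤b 1≤n) (1≤a 1≤n)) (subst (a (b n) <_) (+-comm (a n) (b n)) lt))

Image⁺ : (ℕ → ℕ) → ℕ → Set
Image⁺ f k = ∃[ n ] (n ≥ 1 × k ≡ f n)

Image⁺-pos : ∀ {f k} → (∀ {n} → 1 ≤ n → 1 ≤ f n) → Image⁺ f k → 1 ≤ k
Image⁺-pos f-pos (n , 1≤n , refl) = f-pos 1≤n

Image⁺-∘ : ∀ {f g k} → (∀ {n} → 1 ≤ n → 1 ≤ g n) → Image⁺ (f ∘ g) k → Image⁺ f k
Image⁺-∘ {g = g} g-pos (n , 1≤n , k≡fgn) = g n , g-pos 1≤n , k≡fgn

Image⁺-cong : ∀ {f g k k′} → (∀ {n} → 1 ≤ n → k ≡ f n ⇔ k′ ≡ g n) → Image⁺ f k ⇔ Image⁺ g k′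
Image⁺-cong eqs = mk⇔ (λ (n , 1≤n , e) → n , 1≤n , to (eqs 1≤n) e)
                      (λ (n , 1≤n , e) → n , 1≤n , from (eqs 1≤n) e)

-- The witness is a p − p + 1.
a-jump⇒Image⁺ : ∀ {p} → 1 ≤ p → 2 + a p ≤ a (suc p) → Image⁺ a p
a-jump⇒Image⁺ {p} 1≤p jump with m≤n⇒∃[o]m+o≡n (n≤a 1≤p)
... | c , p+c≡ap = suc c , s≤s z≤n , ≤-antisym (n+c≡a⇒≤a[1+c] 1≤p p+c≡ap) (≮⇒≥ λ p<a[1+c] →
  <⇒≱ (begin-strict
    a (suc p)       <⟨ to (≤a⇔a<+ (s≤s z≤n) (s≤s z≤n)) p<a[1+c] ⟩
    suc p + suc c   ≡⟨ cong suc (+-suc p c) ⟩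
    2 + (p + c)     ≡⟨ cong (2 +_) p+c≡ap ⟩
    2 + a p         ∎) jump)
  where open ≤-Reasoning

Image⁺-a⇒Image⁺-b-suc-a : ∀ {p} → Image⁺ a p → Image⁺ b (suc (a p))
Image⁺-a⇒Image⁺-b-suc-a (j , 1≤j , refl) = j , 1≤j , suc∘a∘a≡b 1≤j

gap⇒Image⁺-b : ∀ {p k} → 1 ≤ p → a p < k → k < a (suc p) → Image⁺ b k
gap⇒Image⁺-b {p} {k} 1≤p ap<k k<a[1+p] =
  subst (Image⁺ b) (sym k≡1+ap)
    (Image⁺-a⇒Image⁺-b-suc-a (a-jump⇒Image⁺ 1≤p (≤-<-trans ap<k k<a[1+p])))
  where
  k≡1+ap : k ≡ suc (a p)
  k≡1+ap = ≤-antisym (s≤s⁻¹ (≤-trans k<a[1+p] (a-suc≤2+a 1≤p))) ap<k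

Image⁺-a⊎b : ∀ {k} → 1 ≤ k → Image⁺ a k ⊎ Image⁺ b k
Image⁺-a⊎b {k} 1≤k with StrictlyIncreasing.bracket a-<-suc {k} z≤n
... | zero , _ , k<a1 = contradiction 1≤k (<⇒≱ k<a1)
... | suc p , ap≤k , k<a[1+p] with m≤n⇒m<n∨m≡n ap≤k
...   | inj₁ ap<k = inj₂ (gap⇒Image⁺-b {suc p} (s≤s z≤n) ap<k k<a[1+p])
...   | inj₂ ap≡k = inj₁ (suc p , s≤s z≤n , sym ap≡k)

Image⁺-a-disjoint-b : ∀ {k} → ¬ (Image⁺ a k × Image⁺ b k)
Image⁺-a-disjoint-b ((j , 1≤j , k≡aj) , (n , 1≤n , k≡bn)) =
  <-irrefl (trans bn≡aj (cong a j≡1+an)) (b<a∘suc∘a 1≤n)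
  where
  bn≡aj : b n ≡ a j
  bn≡aj = trans (sym k≡bn) k≡aj
  j≡1+an : j ≡ suc (a n)
  j≡1+an = +-cancelˡ-≡ (a j) _ _ (begin
    a j + j           ≡⟨ suc∘a∘a≡b 1≤j ⟨
    suc (a (a j))     ≡⟨ cong (suc ∘ a) bn≡aj ⟨
    suc (a (b n))     ≡⟨ cong suc (a∘b≡a+b 1≤n) ⟩
    suc (a n + b n)   ≡⟨ cong (λ x → suc (a n + x)) bn≡aj ⟩
    suc (a n + a j)   ≡⟨ cong suc (+-comm (a n) (a j)) ⟩
    suc (a j + a n)   ≡⟨ +-suc (a j) (a n) ⟨
    a j + suc (a n)   ∎)
    where open ≡-Reasoning

Image⁺-a∘a-disjoint-a∘b : ∀ {k} → ¬ (Image⁺ (a ∘ a) k × Image⁺ (a ∘ b) k)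
Image⁺-a∘a-disjoint-a∘b ((n , 1≤n , k≡aan) , (m , 1≤m , k≡abm)) =
  Image⁺-a-disjoint-b ((n , 1≤n , bm≡an) , (m , 1≤m , refl))
  where
  bm≡an : b m ≡ a n
  bm≡an = StrictlyIncreasing.injective a-<-suc (trans (sym k≡abm) k≡aan)

1*a+1*≡b : ∀ n → 1 * a n + 1 * n ≡ b n
1*a+1*≡b n = cong₂ _+_ (*-identityˡ (a n)) (*-identityˡ n)

InR₁₀⇔Image⁺-b : ∀ {k} → InR 1 0 k ⇔ Image⁺ b k
InR₁₀⇔Image⁺-b {k} = Image⁺-cong λ {n} _ → ≡-cong₂⇔ (+-identityʳ k) (1*a+1*≡b n)

InR₁₁⇔Image⁺-a∘a : ∀ {k} → InR 1 1 k ⇔ Image⁺ (a ∘ a) k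
InR₁₁⇔Image⁺-a∘a {k} = Image⁺-cong λ {n} 1≤n →
  ⇔-trans (≡-cong₂⇔ (+-comm k 1) (trans (1*a+1*≡b n) (sym (suc∘a∘a≡b 1≤n))))
          (mk⇔ suc-injective (cong suc))

InR₂₀⇔Image⁺-a∘b : ∀ {k} → InR 2 0 k ⇔ Image⁺ (a ∘ b) k
InR₂₀⇔Image⁺-a∘b {k} = Image⁺-cong λ {n} 1≤n →
  ≡-cong₂⇔ (+-identityʳ k) (trans (2*x+1*y≡x+[x+y] (a n) n) (sym (a∘b≡a+b 1≤n)))
  where
  2*x+1*y≡x+[x+y] : ∀ x y → 2 * x + 1 * y ≡ x + (x + y)
  2*x+1*y≡x+[x+y] = solve-∀

InR-cover : ∀ {k} → 1 ≤ k → InR 1 0 k ⊎ InR 1 1 k ⊎ InR 2 0 k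
InR-cover 1≤k with Image⁺-a⊎b 1≤k
... | inj₂ k∈b = inj₁ (from InR₁₀⇔Image⁺-b k∈b)
... | inj₁ (j , 1≤j , k≡aj) with Image⁺-a⊎b 1≤j
...   | inj₁ (n , 1≤n , j≡an) =
  inj₂ (inj₁ (from InR₁₁⇔Image⁺-a∘a (n , 1≤n , trans k≡aj (cong a j≡an))))
...   | inj₂ (n , 1≤n , j≡bn) =
  inj₂ (inj₂ (from InR₂₀⇔Image⁺-a∘b (n , 1≤n , trans k≡aj (cong a j≡bn))))

InR-pos : ∀ {k} → InR 1 0 k ⊎ InR 1 1 k ⊎ InR 2 0 k → 1 ≤ k
InR-pos (inj₁ r)         = Image⁺-pos 1≤b (to InR₁₀⇔Image⁺-b r)
InR-pos (inj₂ (inj₁ r))  = Image⁺-pos (1≤a ∘ 1≤a) (to InR₁₁⇔Image⁺-a∘a r)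
InR-pos (inj₂ (inj₂ r))  = Image⁺-pos (1≤a ∘ 1≤b) (to InR₂₀⇔Image⁺-a∘b r)

corollary3p3 : ((k : ℕ) → k ≥ 1 → InR 1 0 k ⊎ InR 1 1 k ⊎ InR 2 0 k)
    × ((k : ℕ) → InR 1 0 k ⊎ InR 1 1 k ⊎ InR 2 0 k → k ≥ 1)
    × ((k : ℕ) → ¬ (InR 1 0 k × InR 1 1 k))
    × ((k : ℕ) → ¬ (InR 1 0 k × InR 2 0 k))
    × ((k : ℕ) → ¬ (InR 1 1 k × InR 2 0 k))
corollary3p3 =
    (λ _ → InR-cover)
  , (λ _ → InR-pos)
  , (λ _ (r₁₀ , r₁₁) →
       Image⁺-a-disjoint-b (Image⁺-∘ 1≤a (to InR₁₁⇔Image⁺-a∘a r₁₁) , to InR₁₀⇔Image⁺-b r₁₀))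
  , (λ _ (r₁₀ , r₂₀) →
       Image⁺-a-disjoint-b (Image⁺-∘ 1≤b (to InR₂₀⇔Image⁺-a∘b r₂₀) , to InR₁₀⇔Image⁺-b r₁₀))
  , (λ _ (r₁₁ , r₂₀) → Image⁺-a∘a-disjoint-a∘b (to InR₁₁⇔Image⁺-a∘a r₁₁ , to InR₂₀⇔Image⁺-a∘b r₂₀))
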